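{- Let $r \geq 2$ be an integer, $K>0$ and $0 < \varepsilon < 1$ real numbers. Let $V_1, \dots, V_r$ be pairwise disjoint finite nonempty vertex sets and $H\subseteq V_1 \times \cdots \times V_r$ an $r$-partite $r$-uniform hypergraph with $\lvert E(H) \rvert \geq \frac{1}{K}\prod_{i\in [r]} \lvert V_i\rvert$. Then there exists $U\subseteq V_1$ such that (a) $\lvert U \rvert \geq \frac{\lvert V_1\rvert}{4K}$; (b) at least a $(1 - \varepsilon)$-fraction of the ordered pairs $(v, w)\in U\times U$ have at least $\frac{\varepsilon}{2K^2} \prod_{2 \leq i \leq r} \lvert V_i\rvert$ $1$-th $r$-legs on $(v, w)$ in $H$; (c) every vertex $u\in U$ has degree at least $\frac{1}{2K}\prod_{2 \leq i \leq r} \lvert V_i\rvert$ in $H$.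
   Context: Edges of $H$ are ordered tuples in $V_1\times\cdots\times V_r$; the degree of $u\in V_1$ is the number of edges containing $u$. For $v,w\in V_1$, a $1$-th $r$-leg on $(v,w)$ in $H$ is determined by a tuple $(u_2,\dots,u_r)\in V_2\times\cdots\times V_r$ such that both $(v,u_2,\dots,u_r)$ and $(w,u_2,\dots,u_r)$ are edges of $H$; the number of $1$-th $r$-legs on $(v,w)$ is the number of such tuples (i.e. the number of common neighbours of $v$ and $w$ in $V_2\times\cdots\times V_r$).
   Formalization: The parameters K and ε are rational rather than real numbers. -}

module Defs where

open import Data.Nat using (ℕ; zero; suc; _+_; _*_)
open import Data.Fin using (Fin; zero; suc)
open import Data.Bool using (Bool; true; false; _∧_)
open import Data.List using (List; []; _∷_; concatMap; map; length; filter)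
open import Data.List using (allFin)
open import Data.Product using (_×_; _,_; proj₁; proj₂)
open import Data.Fin.Subset using (Subset; _∈_)
open import Data.Fin.Subset.Properties using (_∈?_)
open import Relation.Nullary.Decidable using (Dec; does)
open import Data.Rational using (ℚ; Positive; 1/_)
open import Data.Rational.Properties using (pos⇒nonZero)

-- Vertex classes: V_i = Fin (n i) for i : Fin k (distinct index types, hence
-- pairwise disjoint).  A tuple in V_1 × ⋯ × V_k:
Tuple : (k : ℕ) → (Fin k → ℕ) → Set
Tuple k n = (i : Fin k) → Fin (n i)

cons : ∀ {k} {n : Fin (suc k) → ℕ} → Fin (n zero) → Tuple k (λ i → n (suc i)) → Tuple (suc k) n
cons u t zero = u
cons u t (suc i) = t i

allTuples : (k : ℕ) (n : Fin k → ℕ) → List (Tuple k n)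
allTuples zero n = (λ ()) ∷ []
allTuples (suc k) n =
  concatMap (λ u → map (cons u) (allTuples k (λ i → n (suc i)))) (allFin (n zero))

countB : ∀ {A : Set} → (A → Bool) → List A → ℕ
countB p [] = 0
countB p (x ∷ xs) with p x
... | true  = suc (countB p xs)
... | false = countB p xs

prodSizes : (k : ℕ) → (Fin k → ℕ) → ℕ
prodSizes zero n = 1
prodSizes (suc k) n = n zero * prodSizes k (λ i → n (suc i))

Hypergraph : (r : ℕ) → (Fin r → ℕ) → Set
Hypergraph r n = Tuple r n → Bool

numEdges : ∀ {r} {n : Fin r → ℕ} → Hypergraph r n → ℕ
numEdges {r} {n} H = countB H (allTuples r n)

degree : ∀ {k} {n : Fin (suc k) → ℕ} → Hypergraph (suc k) n → Fin (n zero) → ℕ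
degree {k} {n} H u = countB (λ t → H (cons u t)) (allTuples k (λ i → n (suc i)))

legs : ∀ {k} {n : Fin (suc k) → ℕ} → Hypergraph (suc k) n → Fin (n zero) → Fin (n zero) → ℕ
legs {k} {n} H v w =
  countB (λ t → H (cons v t) ∧ H (cons w t)) (allTuples k (λ i → n (suc i)))

allPairs : (m : ℕ) → List (Fin m × Fin m)
allPairs m = concatMap (λ v → map (λ w → (v , w)) (allFin m)) (allFin m)

countPairsIn : ∀ {m} → Subset m → (Fin m → Fin m → Bool) → ℕ
countPairsIn {m} U P =
  countB (λ vw → does (proj₁ vw ∈? U) ∧ does (proj₂ vw ∈? U) ∧ P (proj₁ vw) (proj₂ vw)) (allPairs m)

inv : (K : ℚ) → .{{Positive K}} → ℚ
inv K = 1/_ K {{pos⇒nonZero K}}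

ℕ→ℚ : ℕ → ℚ
ℕ→ℚ k = (+ k) / 1
  where open import Data.Integer using (+_)
        open import Data.Rational using (_/_)

{-# OPTIONS --safe #-}
-- Dependent random choice.  Write Q = |V₂|⋯|V_r| and let U₀ ⊆ V₁ be the vertices of
-- degree at least Q/2K; the other vertices carry fewer than |V₁|Q/2K edges, so U₀ meets
-- at least (|V₁| + |U₀|)Q/2K of them.  For a uniformly random t ∈ V₂ × ⋯ × V_r let
-- U(t) = U₀ ∩ N(t), X = |U(t)| and Y the number of pairs in U(t) with fewer than εQ/2K²
-- legs.  By Cauchy–Schwarz E[X²] ≥ (E X)² ≥ ((|V₁| + |U₀|)/2K)², and a pair (v, w) lies
-- in U(t) with probability legs(v, w)/Q, so E[Y] ≤ ε|U₀|²/2K².  Hence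
-- E[X² − Y/ε] ≥ (|V₁|/4K)², and a tuple t attaining this has |U(t)| ≥ |V₁|/4K and at most
-- εX² pairs with few legs.  The computation is carried out in ℕ with K = p/q and ε = a/b.
module Submission where

module Sums where

  open import Data.Bool using (Bool; true; false; _∧_; not)
  open import Data.List using (List; []; _∷_; _++_; map; concatMap; length)
  open import Data.Nat
  open import Data.Nat.Properties
  open import Algebra.Properties.CommutativeSemigroup +-commutativeSemigroup using (interchange)
  open import Data.Nat.Tactic.RingSolver using (solve; solve-∀)
  open import Data.Product using (∃; _,_; map₂)
  open import Data.Sum using ([_,_]′)
  open import Defs using (countB)
  open import Relation.Nullary using (yes; no)
  open import Relation.Binary.PropositionalEquality

  private variable
    A B : Set

  χ : Bool → ℕ
  χ true = 1
  χ false = 0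

  χ≤1 : ∀ b → χ b ≤ 1
  χ≤1 true = ≤-refl
  χ≤1 false = z≤n

  χ-∧ : ∀ b c → χ (b ∧ c) ≡ χ b * χ c
  χ-∧ true c = sym (+-identityʳ (χ c))
  χ-∧ false c = refl

  χ-∧³ : ∀ a b c → χ (a ∧ b ∧ c) ≡ χ a * χ b * χ c
  χ-∧³ false b c = refl
  χ-∧³ true false c = refl
  χ-∧³ true true c = sym (+-identityʳ (χ c))

  χ+χ-not : ∀ b → χ b + χ (not b) ≡ 1
  χ+χ-not true = refl
  χ+χ-not false = refl

  ∑ : List A → (A → ℕ) → ℕ
  ∑ [] f = 0
  ∑ (x ∷ xs) f = f x + ∑ xs f

  syntax ∑ xs (λ x → e) = ∑[ x ∈ xs ] e

  countB≡∑χ : ∀ (P : A → Bool) xs → countB P xs ≡ ∑[ x ∈ xs ] χ (P x)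
  countB≡∑χ P [] = refl
  countB≡∑χ P (x ∷ xs) with P x
  ... | true = cong suc (countB≡∑χ P xs)
  ... | false = countB≡∑χ P xs

  ∑-cong : ∀ xs {f g : A → ℕ} → (∀ x → f x ≡ g x) → ∑ xs f ≡ ∑ xs g
  ∑-cong [] _ = refl
  ∑-cong (x ∷ xs) f≡g = cong₂ _+_ (f≡g x) (∑-cong xs f≡g)

  ∑-mono-≤ : ∀ xs {f g : A → ℕ} → (∀ x → f x ≤ g x) → ∑ xs f ≤ ∑ xs g
  ∑-mono-≤ [] _ = z≤n
  ∑-mono-≤ (x ∷ xs) f≤g = +-mono-≤ (f≤g x) (∑-mono-≤ xs f≤g)

  ∑-zero : ∀ (xs : List A) → ∑[ x ∈ xs ] 0 ≡ 0
  ∑-zero [] = refl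
  ∑-zero (x ∷ xs) = ∑-zero xs

  ∑-const : ∀ (xs : List A) c → ∑[ x ∈ xs ] c ≡ length xs * c
  ∑-const [] c = refl
  ∑-const (x ∷ xs) c = cong (c +_) (∑-const xs c)

  length≡∑1 : ∀ (xs : List A) → length xs ≡ ∑[ x ∈ xs ] 1
  length≡∑1 [] = refl
  length≡∑1 (x ∷ xs) = cong suc (length≡∑1 xs)

  ∑-distrib-+ : ∀ xs (f g : A → ℕ) → ∑[ x ∈ xs ] (f x + g x) ≡ ∑ xs f + ∑ xs g
  ∑-distrib-+ [] f g = refl
  ∑-distrib-+ (x ∷ xs) f g = begin
    f x + g x + ∑[ y ∈ xs ] (f y + g y)  ≡⟨ cong (f x + g x +_) (∑-distrib-+ xs f g) ⟩
    f x + g x + (∑ xs f + ∑ xs g)        ≡⟨ interchange (f x) (g x) (∑ xs f) (∑ xs g) ⟩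
    f x + ∑ xs f + (g x + ∑ xs g)        ∎
    where open ≡-Reasoning

  *-distribˡ-∑ : ∀ c xs (f : A → ℕ) → c * ∑ xs f ≡ ∑[ x ∈ xs ] (c * f x)
  *-distribˡ-∑ c [] f = *-zeroʳ c
  *-distribˡ-∑ c (x ∷ xs) f = trans (*-distribˡ-+ c (f x) (∑ xs f)) (cong (c * f x +_) (*-distribˡ-∑ c xs f))

  *-distribʳ-∑ : ∀ c xs (f : A → ℕ) → ∑ xs f * c ≡ ∑[ x ∈ xs ] (f x * c)
  *-distribʳ-∑ c xs f = begin
    ∑ xs f * c             ≡⟨ *-comm (∑ xs f) c ⟩
    c * ∑ xs f             ≡⟨ *-distribˡ-∑ c xs f ⟩
    ∑[ x ∈ xs ] (c * f x)  ≡⟨ ∑-cong xs (λ x → *-comm c (f x)) ⟩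
    ∑[ x ∈ xs ] (f x * c)  ∎
    where open ≡-Reasoning

  ∑-*-∑ : ∀ (xs : List A) (ys : List B) f g → ∑ xs f * ∑ ys g ≡ ∑[ x ∈ xs ] ∑[ y ∈ ys ] (f x * g y)
  ∑-*-∑ xs ys f g = trans (*-distribʳ-∑ (∑ ys g) xs f) (∑-cong xs (λ x → *-distribˡ-∑ (f x) ys g))

  ∑-++ : ∀ xs ys (f : A → ℕ) → ∑ (xs ++ ys) f ≡ ∑ xs f + ∑ ys f
  ∑-++ [] ys f = refl
  ∑-++ (x ∷ xs) ys f = trans (cong (f x +_) (∑-++ xs ys f)) (sym (+-assoc (f x) (∑ xs f) (∑ ys f)))

  ∑-map : ∀ (g : A → B) xs (f : B → ℕ) → ∑ (map g xs) f ≡ ∑[ x ∈ xs ] f (g x)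
  ∑-map g [] f = refl
  ∑-map g (x ∷ xs) f = cong (f (g x) +_) (∑-map g xs f)

  ∑-concatMap : ∀ (g : A → List B) xs (f : B → ℕ) → ∑ (concatMap g xs) f ≡ ∑[ x ∈ xs ] ∑ (g x) f
  ∑-concatMap g [] f = refl
  ∑-concatMap g (x ∷ xs) f = trans (∑-++ (g x) (concatMap g xs) f) (cong (∑ (g x) f +_) (∑-concatMap g xs f))

  ∑-comm : ∀ (xs : List A) (ys : List B) (f : A → B → ℕ) →
           ∑[ x ∈ xs ] ∑[ y ∈ ys ] f x y ≡ ∑[ y ∈ ys ] ∑[ x ∈ xs ] f x y
  ∑-comm [] ys f = sym (∑-zero ys)
  ∑-comm (x ∷ xs) ys f = trans (cong (∑ ys (f x) +_) (∑-comm xs ys f)) (sym (∑-distrib-+ ys (f x) _))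

  2mn≤m²+n² : ∀ m n → 2 * (m * n) ≤ m * m + n * n
  2mn≤m²+n² m n = [ below , below-swapped ]′ (≤-total m n)
    where
    below : ∀ {x y} → x ≤ y → 2 * (x * y) ≤ x * x + y * y
    below {x} x≤y with d , refl ← m≤n⇒∃[o]m+o≡n x≤y = begin
      2 * (x * (x + d))          ≤⟨ m≤m+n _ (d * d) ⟩
      2 * (x * (x + d)) + d * d  ≡⟨ solve (x ∷ d ∷ []) ⟩
      x * x + (x + d) * (x + d)  ∎
      where open ≤-Reasoning
    below-swapped : n ≤ m → 2 * (m * n) ≤ m * m + n * n
    below-swapped n≤m = subst₂ _≤_ (cong (2 *_) (*-comm n m)) (+-comm (n * n) (m * m)) (below n≤m)

  2c∑≤n*c²+∑² : ∀ c xs (f : A → ℕ) →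
                2 * (c * ∑ xs f) ≤ length xs * (c * c) + ∑[ x ∈ xs ] (f x * f x)
  2c∑≤n*c²+∑² c xs f = begin
    2 * (c * ∑ xs f)                          ≡⟨ cong (2 *_) (*-distribˡ-∑ c xs f) ⟩
    2 * ∑[ x ∈ xs ] (c * f x)                 ≡⟨ *-distribˡ-∑ 2 xs _ ⟩
    ∑[ x ∈ xs ] (2 * (c * f x))               ≤⟨ ∑-mono-≤ xs (λ x → 2mn≤m²+n² c (f x)) ⟩
    ∑[ x ∈ xs ] (c * c + f x * f x)           ≡⟨ ∑-distrib-+ xs _ _ ⟩
    ∑[ x ∈ xs ] (c * c) + ∑[ x ∈ xs ] (f x * f x)  ≡⟨ cong (_+ _) (∑-const xs (c * c)) ⟩
    length xs * (c * c) + ∑[ x ∈ xs ] (f x * f x)  ∎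
    where open ≤-Reasoning

  cauchy-schwarz : ∀ xs (f : A → ℕ) → ∑ xs f * ∑ xs f ≤ length xs * ∑[ x ∈ xs ] (f x * f x)
  cauchy-schwarz [] f = z≤n
  cauchy-schwarz (x ∷ xs) f = begin
    (c + s) * (c + s)                  ≡⟨ expand c s ⟩
    c * c + 2 * (c * s) + s * s        ≤⟨ +-mono-≤ (+-monoʳ-≤ (c * c) (2c∑≤n*c²+∑² c xs f)) (cauchy-schwarz xs f) ⟩
    c * c + (n * (c * c) + t) + n * t  ≡⟨ collect c n t ⟩
    suc n * (c * c + t)                ∎
    where
    open ≤-Reasoning
    c = f x
    s = ∑ xs f
    t = ∑[ y ∈ xs ] (f y * f y)
    n = length xs
    expand : ∀ c s → (c + s) * (c + s) ≡ c * c + 2 * (c * s) + s * s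
    expand = solve-∀
    collect : ∀ c n t → c * c + (n * (c * c) + t) + n * t ≡ suc n * (c * c + t)
    collect = solve-∀

  ∑-<⇒∃-< : ∀ xs {f g : A → ℕ} → ∑ xs f < ∑ xs g → ∃ λ x → f x < g x
  ∑-<⇒∃-< [] ()
  ∑-<⇒∃-< (x ∷ xs) {f} {g} lt with f x <? g x
  ... | yes fx<gx = x , fx<gx
  ... | no fx≮gx = ∑-<⇒∃-< xs (+-cancelˡ-< (g x) _ _ (≤-<-trans (+-monoˡ-≤ (∑ xs f) (≮⇒≥ fx≮gx)) lt))

  ∑-≤⇒∃-≤ : ∀ xs {f g : A → ℕ} → 0 < length xs → ∑ xs f ≤ ∑ xs g → ∃ λ x → f x ≤ g x
  ∑-≤⇒∃-≤ [] ()
  ∑-≤⇒∃-≤ (x ∷ xs) {f} {g} _ le with f x ≤? g x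
  ... | yes fx≤gx = x , fx≤gx
  ... | no fx≰gx = map₂ <⇒≤ (∑-<⇒∃-< xs (+-cancelˡ-< (f x) _ _ (≤-<-trans le (+-monoˡ-< (∑ xs g) (≰⇒> fx≰gx)))))

module HypergraphCounting where

  open import Data.Bool using (Bool; true; false; _∧_)
  open import Data.Fin using (Fin; zero; suc)
  open import Data.Fin.Subset using (Subset; _∈_; ∣_∣)
  open import Data.Fin.Subset.Properties using (_∈?_)
  open import Data.List using (length; allFin)
  open import Data.List.Properties using (length-tabulate; map-tabulate)
  open import Data.Nat
  open import Data.Nat.Properties
  open import Data.Product using (_,_; _×_)
  open import Data.Vec using (tabulate; lookup; _∷_)
  open import Data.Vec.Properties using (lookup∘tabulate; []=⇒lookup)
  open import Function using (id)
  open import Relation.Binary.PropositionalEquality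
  open import Relation.Nullary.Decidable using (does)
  open import Defs
  open Sums

  ∑-allFin-suc : ∀ k (f : Fin (suc k) → ℕ) → ∑ (allFin (suc k)) f ≡ f zero + ∑[ i ∈ allFin k ] f (suc i)
  ∑-allFin-suc k f =
    cong (f zero +_) (trans (cong (λ is → ∑ is f) (sym (map-tabulate id suc))) (∑-map suc (allFin k) f))

  ∑-allTuples : ∀ k (n : Fin (suc k) → ℕ) (f : Tuple (suc k) n → ℕ) →
                ∑ (allTuples (suc k) n) f ≡ ∑[ u ∈ allFin (n zero) ] ∑[ t ∈ allTuples k (λ i → n (suc i)) ] f (cons u t)
  ∑-allTuples k n f = trans (∑-concatMap _ (allFin (n zero)) f)
                            (∑-cong (allFin (n zero)) (λ u → ∑-map (cons u) (allTuples k (λ i → n (suc i))) f))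

  ∑-allPairs : ∀ k (f : Fin k × Fin k → ℕ) → ∑ (allPairs k) f ≡ ∑[ v ∈ allFin k ] ∑[ w ∈ allFin k ] f (v , w)
  ∑-allPairs k f = trans (∑-concatMap _ (allFin k) f) (∑-cong (allFin k) (λ v → ∑-map (v ,_) (allFin k) f))

  length-allTuples : ∀ k (n : Fin k → ℕ) → length (allTuples k n) ≡ prodSizes k n
  length-allTuples zero n = refl
  length-allTuples (suc k) n = begin
    length (allTuples (suc k) n)                            ≡⟨ length≡∑1 (allTuples (suc k) n) ⟩
    ∑[ t ∈ allTuples (suc k) n ] 1                          ≡⟨ ∑-allTuples k n (λ _ → 1) ⟩
    ∑[ u ∈ allFin (n zero) ] ∑[ t ∈ allTuples k n⁺ ] 1      ≡⟨ ∑-cong (allFin (n zero)) (λ _ → sym (length≡∑1 (allTuples k n⁺))) ⟩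
    ∑[ u ∈ allFin (n zero) ] length (allTuples k n⁺)        ≡⟨ ∑-const (allFin (n zero)) _ ⟩
    length (allFin (n zero)) * length (allTuples k n⁺)      ≡⟨ cong₂ _*_ (length-tabulate {n = n zero} id) (length-allTuples k n⁺) ⟩
    n zero * prodSizes k n⁺                                 ∎
    where
    open ≡-Reasoning
    n⁺ : Fin k → ℕ
    n⁺ i = n (suc i)

  numEdges≡∑degree : ∀ {k} {n : Fin (suc k) → ℕ} (H : Hypergraph (suc k) n) →
                     numEdges H ≡ ∑[ u ∈ allFin (n zero) ] degree H u
  numEdges≡∑degree {k} {n} H = begin
    numEdges H                                                        ≡⟨ countB≡∑χ H (allTuples (suc k) n) ⟩
    ∑[ t ∈ allTuples (suc k) n ] χ (H t)                              ≡⟨ ∑-allTuples k n (λ t → χ (H t)) ⟩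
    ∑[ u ∈ allFin (n zero) ] ∑[ t ∈ allTuples k _ ] χ (H (cons u t))
        ≡⟨ ∑-cong (allFin (n zero)) (λ u → sym (countB≡∑χ (λ t → H (cons u t)) (allTuples k _))) ⟩
    ∑[ u ∈ allFin (n zero) ] degree H u                               ∎
    where open ≡-Reasoning

  ∣tabulate∣≡∑χ : ∀ {k} (f : Fin k → Bool) → ∣ tabulate f ∣ ≡ ∑[ u ∈ allFin k ] χ (f u)
  ∣tabulate∣≡∑χ {zero} f = refl
  ∣tabulate∣≡∑χ {suc k} f = begin
    ∣ f zero ∷ tabulate (λ i → f (suc i)) ∣                  ≡⟨ ∣∷∣ (f zero) (tabulate (λ i → f (suc i))) ⟩
    χ (f zero) + ∣ tabulate (λ i → f (suc i)) ∣              ≡⟨ cong (χ (f zero) +_) (∣tabulate∣≡∑χ (λ i → f (suc i))) ⟩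
    χ (f zero) + ∑[ i ∈ allFin k ] χ (f (suc i))             ≡⟨ ∑-allFin-suc k (λ i → χ (f i)) ⟨
    ∑[ u ∈ allFin (suc k) ] χ (f u)                          ∎
    where
    open ≡-Reasoning
    ∣∷∣ : ∀ b (p : Subset k) → ∣ b ∷ p ∣ ≡ χ b + ∣ p ∣
    ∣∷∣ true p = refl
    ∣∷∣ false p = refl

  does-∈?≡lookup : ∀ {k} (u : Fin k) (p : Subset k) → does (u ∈? p) ≡ lookup p u
  does-∈?≡lookup zero (true ∷ p) = refl
  does-∈?≡lookup zero (false ∷ p) = refl
  does-∈?≡lookup (suc u) (_ ∷ p) = does-∈?≡lookup u p

  ∈-tabulate⁻ : ∀ {k} {f : Fin k → Bool} {u} → u ∈ tabulate f → f u ≡ true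
  ∈-tabulate⁻ {f = f} {u} u∈ = trans (sym (lookup∘tabulate f u)) ([]=⇒lookup u∈)

  countPairsIn-tabulate : ∀ {k} (f : Fin k → Bool) (P : Fin k → Fin k → Bool) →
    countPairsIn (tabulate f) P ≡ ∑[ v ∈ allFin k ] ∑[ w ∈ allFin k ] χ (f v ∧ f w ∧ P v w)
  countPairsIn-tabulate {k} f P = begin
    countPairsIn (tabulate f) P                                      ≡⟨ countB≡∑χ _ (allPairs k) ⟩
    ∑[ vw ∈ allPairs k ] χ (inPair vw)                               ≡⟨ ∑-allPairs k _ ⟩
    ∑[ v ∈ allFin k ] ∑[ w ∈ allFin k ] χ (inPair (v , w))           ≡⟨ ∑-cong (allFin k) (λ v → ∑-cong (allFin k) (λ w →
                                                                          cong₂ (λ x y → χ (x ∧ y ∧ P v w)) (lookup-f v) (lookup-f w))) ⟩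
    ∑[ v ∈ allFin k ] ∑[ w ∈ allFin k ] χ (f v ∧ f w ∧ P v w)        ∎
    where
    open ≡-Reasoning
    inPair : Fin k × Fin k → Bool
    inPair (v , w) = does (v ∈? tabulate f) ∧ does (w ∈? tabulate f) ∧ P v w
    lookup-f : ∀ u → does (u ∈? tabulate f) ≡ f u
    lookup-f u = trans (does-∈?≡lookup u (tabulate f)) (lookup∘tabulate f u)

  prodSizes-nonZero : ∀ k (n : Fin k → ℕ) → (∀ i → 1 ≤ n i) → NonZero (prodSizes k n)
  prodSizes-nonZero zero n _ = _
  prodSizes-nonZero (suc k) n n≥1 =
    m*n≢0 (n zero) _ {{>-nonZero (n≥1 zero)}} {{prodSizes-nonZero k (λ i → n (suc i)) (λ i → n≥1 (suc i))}}

module Arithmetic where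

  open import Data.List using ([]; _∷_)
  open import Data.Nat
  open import Data.Nat.Properties
  open import Data.Nat.Tactic.RingSolver using (solve)
  open import Data.Product using (_×_; _,_)
  open import Relation.Binary.PropositionalEquality

  m*m≤n*n⇒m≤n : ∀ {m n} → m * m ≤ n * n → m ≤ n
  m*m≤n*n⇒m≤n m*m≤n*n = ≮⇒≥ (λ n<m → <⇒≱ (*-mono-< n<m n<m) m*m≤n*n)

  n²+8m²≤4[n+m]² : ∀ {m n} → m ≤ n → n * n + 8 * (m * m) ≤ 4 * ((n + m) * (n + m))
  n²+8m²≤4[n+m]² {m} {n} m≤n = begin
    n * n + 8 * (m * m)                                  ≤⟨ +-monoʳ-≤ (n * n) (*-monoʳ-≤ 8 (*-monoˡ-≤ m m≤n)) ⟩
    n * n + 8 * (n * m)                                  ≤⟨ m≤m+n _ (3 * (n * n) + 4 * (m * m)) ⟩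
    n * n + 8 * (n * m) + (3 * (n * n) + 4 * (m * m))    ≡⟨ solve (m ∷ n ∷ []) ⟩
    4 * ((n + m) * (n + m))                              ∎
    where open ≤-Reasoning

  -- The averaging step, with K = p/q, ε = a/b, u = |U₀|, S = ∑ X, ΣX² = ∑ X² and ΣY = ∑ Y
  -- over the Q tuples: from S ≥ (N + u)Q/2K, S² ≤ Q·ΣX² and ΣY ≤ εu²Q/2K² it follows that
  -- Q(N/4K)² + ΣY/ε ≤ ΣX².
  average-demand≤supply : ∀ {p q a b N u Q S ΣX² ΣY} .{{_ : NonZero Q}} → u ≤ N →
    (N + u) * (q * Q) ≤ 2 * p * S →
    S * S ≤ Q * ΣX² →
    2 * p * p * (b * ΣY) ≤ u * u * (a * q * q * Q) →
    Q * (a * (N * q * (N * q))) + 16 * p * p * (b * ΣY) ≤ 16 * p * p * (a * ΣX²)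
  average-demand≤supply {p} {q} {a} {b} {N} {u} {Q} {S} {ΣX²} {ΣY} u≤N edges cauchy-schwarz fewLegs =
    *-cancelˡ-≤ Q (begin
      Q * (Q * (a * (N * q * (N * q))) + 16 * p * p * (b * ΣY))        ≡⟨ solve (p ∷ q ∷ a ∷ b ∷ N ∷ Q ∷ ΣY ∷ []) ⟩
      a * q * q * Q * Q * (N * N) + 8 * Q * (2 * p * p * (b * ΣY))       ≤⟨ +-monoʳ-≤ _ (*-monoʳ-≤ (8 * Q) fewLegs) ⟩
      a * q * q * Q * Q * (N * N) + 8 * Q * (u * u * (a * q * q * Q))    ≡⟨ solve (q ∷ a ∷ N ∷ u ∷ Q ∷ []) ⟩
      a * q * q * Q * Q * (N * N + 8 * (u * u))                         ≤⟨ *-monoʳ-≤ (a * q * q * Q * Q) (n²+8m²≤4[n+m]² u≤N) ⟩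
      a * q * q * Q * Q * (4 * ((N + u) * (N + u)))                     ≡⟨ solve (q ∷ a ∷ N ∷ u ∷ Q ∷ []) ⟩
      4 * a * ((N + u) * (q * Q) * ((N + u) * (q * Q)))                 ≤⟨ *-monoʳ-≤ (4 * a) (*-mono-≤ edges edges) ⟩
      4 * a * (2 * p * S * (2 * p * S))                                 ≡⟨ solve (p ∷ a ∷ S ∷ []) ⟩
      16 * p * p * a * (S * S)                                          ≤⟨ *-monoʳ-≤ (16 * p * p * a) cauchy-schwarz ⟩
      16 * p * p * a * (Q * ΣX²)                                        ≡⟨ solve (p ∷ a ∷ Q ∷ ΣX² ∷ []) ⟩
      Q * (16 * p * p * (a * ΣX²))                                      ∎)
    where open ≤-Reasoning

  demand≤supply⇒success : ∀ {p q a b N X Y} .{{_ : NonZero p}} .{{_ : NonZero a}} →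
    a * (N * q * (N * q)) + 16 * p * p * (b * Y) ≤ 16 * p * p * (a * (X * X)) →
    b * Y ≤ a * (X * X) × N * q ≤ 4 * p * X
  demand≤supply⇒success {p} {q} {a} {b} {N} {X} {Y} demand≤supply =
    *-cancelˡ-≤ (16 * p * p) {{m*n≢0 (16 * p) p {{m*n≢0 16 p}}}} (≤-trans (m≤n+m _ _) demand≤supply) ,
    m*m≤n*n⇒m≤n (*-cancelˡ-≤ a (begin
      a * (N * q * (N * q))                            ≤⟨ m≤m+n _ _ ⟩
      a * (N * q * (N * q)) + 16 * p * p * (b * Y)     ≤⟨ demand≤supply ⟩
      16 * p * p * (a * (X * X))                       ≡⟨ solve (p ∷ a ∷ X ∷ []) ⟩
      a * (4 * p * X * (4 * p * X))                    ∎))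
    where open ≤-Reasoning

module DependentRandomChoice where

  open import Data.Bool using (Bool; true; _∧_; not)
  open import Data.Fin using (Fin; zero; suc)
  open import Data.Fin.Subset using (Subset; _∈_; ∣_∣)
  open import Data.List using (List; length; allFin)
  open import Data.List.Properties using (length-tabulate)
  open import Data.Nat
  open import Data.Nat.Properties
  open import Data.Nat.Tactic.RingSolver using (solve-∀)
  open import Data.Product using (Σ; _×_; _,_; proj₁; proj₂)
  open import Data.Vec using (tabulate)
  open import Function using (id)
  open import Relation.Binary.PropositionalEquality
  open import Relation.Nullary using (¬_; Dec; yes; no)
  open import Relation.Nullary.Decidable using (does)
  open import Defs
  open Sums
  open HypergraphCounting
  open Arithmetic

  y+[x≤y]x≤[x≤y]y+x : ∀ x y (x≤?y : Dec (x ≤ y)) → y + χ (does x≤?y) * x ≤ χ (does x≤?y) * y + x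
  y+[x≤y]x≤[x≤y]y+x x y (yes _) = ≤-reflexive (cong₂ _+_ (sym (*-identityˡ y)) (*-identityˡ x))
  y+[x≤y]x≤[x≤y]y+x x y (no x≰y) = subst (_≤ x) (sym (+-identityʳ y)) (<⇒≤ (≰⇒> x≰y))

  does∧≡true⇒ : ∀ {P : Set} (P? : Dec P) {b} → does P? ∧ b ≡ true → P
  does∧≡true⇒ (yes p) _ = p

  module _ {m : ℕ} {n : Fin (suc m) → ℕ} (H : Hypergraph (suc m) n) (p q : ℕ) where

    private
      N : ℕ
      N = n zero

      n⁺ : Fin m → ℕ
      n⁺ i = n (suc i)

      Q : ℕ
      Q = prodSizes m n⁺

      V : List (Fin N)
      V = allFin N

      T : List (Tuple m n⁺)
      T = allTuples m n⁺

    -- With K = p/q: highDegree marks U₀ = {u | deg u ≥ Q/2K}, and inU t marks U(t) = U₀ ∩ N(t).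
    highDegree : Fin N → Bool
    highDegree u = does (q * Q ≤? 2 * p * degree H u)

    inU : Tuple m n⁺ → Fin N → Bool
    inU t u = highDegree u ∧ H (cons u t)

    size : Tuple m n⁺ → ℕ
    size t = ∑[ u ∈ V ] χ (inU t u)

    u₀ : ℕ
    u₀ = ∑[ u ∈ V ] χ (highDegree u)

    highEdges : ℕ
    highEdges = ∑[ u ∈ V ] (χ (highDegree u) * degree H u)

    u₀≤N : u₀ ≤ N
    u₀≤N = begin
      ∑[ u ∈ V ] χ (highDegree u)  ≤⟨ ∑-mono-≤ V (λ u → χ≤1 (highDegree u)) ⟩
      ∑[ u ∈ V ] 1                 ≡⟨ length≡∑1 V ⟨
      length V                     ≡⟨ length-tabulate {n = N} id ⟩
      N                            ∎
      where open ≤-Reasoning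

    ∑size≡highEdges : ∑ T size ≡ highEdges
    ∑size≡highEdges = begin
      ∑[ t ∈ T ] ∑[ u ∈ V ] χ (inU t u)                           ≡⟨ ∑-comm T V _ ⟩
      ∑[ u ∈ V ] ∑[ t ∈ T ] χ (highDegree u ∧ H (cons u t))       ≡⟨ ∑-cong V (λ u → ∑-cong T (λ t → χ-∧ (highDegree u) _)) ⟩
      ∑[ u ∈ V ] ∑[ t ∈ T ] (χ (highDegree u) * χ (H (cons u t)))  ≡⟨ ∑-cong V (λ u → *-distribˡ-∑ (χ (highDegree u)) T _) ⟨
      ∑[ u ∈ V ] (χ (highDegree u) * ∑[ t ∈ T ] χ (H (cons u t)))  ≡⟨ ∑-cong V (λ u → cong (χ (highDegree u) *_) (countB≡∑χ _ T)) ⟨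
      highEdges                                                    ∎
      where open ≡-Reasoning

    highEdges-lower : N * (q * Q) ≤ p * numEdges H → (N + u₀) * (q * Q) ≤ 2 * p * highEdges
    highEdges-lower edges = +-cancelˡ-≤ (N * x) _ _ (begin
      N * x + (N + u₀) * x                                      ≡⟨ regroup N u₀ x ⟩
      2 * (N * x) + u₀ * x                                      ≤⟨ +-monoˡ-≤ (u₀ * x) (*-monoʳ-≤ 2 edges) ⟩
      2 * (p * numEdges H) + u₀ * x                             ≡⟨ cong₂ _+_ (sym (*-assoc 2 p _)) refl ⟩
      2 * p * numEdges H + u₀ * x                               ≡⟨ cong₂ _+_ (cong (2 * p *_) (numEdges≡∑degree H)) (*-distribʳ-∑ x V _) ⟩
      2 * p * ∑[ u ∈ V ] degree H u + ∑[ u ∈ V ] (χ (highDegree u) * x)   ≡⟨ cong (_+ ∑[ u ∈ V ] (χ (highDegree u) * x)) (*-distribˡ-∑ (2 * p) V _) ⟩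
      ∑[ u ∈ V ] (2 * p * degree H u) + ∑[ u ∈ V ] (χ (highDegree u) * x) ≡⟨ ∑-distrib-+ V _ _ ⟨
      ∑[ u ∈ V ] (2 * p * degree H u + χ (highDegree u) * x)   ≤⟨ ∑-mono-≤ V (λ u → y+[x≤y]x≤[x≤y]y+x x (2 * p * degree H u) (x ≤? 2 * p * degree H u)) ⟩
      ∑[ u ∈ V ] (χ (highDegree u) * (2 * p * degree H u) + x) ≡⟨ ∑-distrib-+ V _ _ ⟩
      ∑[ u ∈ V ] (χ (highDegree u) * (2 * p * degree H u)) + ∑[ u ∈ V ] x
          ≡⟨ cong₂ _+_ (∑-cong V (λ u → swap (χ (highDegree u)) (2 * p) (degree H u))) (∑-const V x) ⟩
      ∑[ u ∈ V ] (2 * p * (χ (highDegree u) * degree H u)) + length V * x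
          ≡⟨ cong₂ _+_ (sym (*-distribˡ-∑ (2 * p) V _)) (cong (_* x) (length-tabulate {n = N} id)) ⟩
      2 * p * highEdges + N * x                                 ≡⟨ +-comm (2 * p * highEdges) (N * x) ⟩
      N * x + 2 * p * highEdges                                 ∎)
      where
      open ≤-Reasoning
      x = q * Q
      regroup : ∀ N u x → N * x + (N + u) * x ≡ 2 * (N * x) + u * x
      regroup = solve-∀
      swap : ∀ c a d → c * (a * d) ≡ a * (c * d)
      swap = solve-∀

    pairsIn : Tuple m n⁺ → (Fin N → Fin N → Bool) → ℕ
    pairsIn t P = ∑[ v ∈ V ] ∑[ w ∈ V ] (χ (inU t v) * χ (inU t w) * χ (P v w))

    pairsIn+pairsIn-not≡size² : ∀ t P → pairsIn t P + pairsIn t (λ v w → not (P v w)) ≡ size t * size t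
    pairsIn+pairsIn-not≡size² t P = begin
      pairsIn t P + pairsIn t (λ v w → not (P v w))                        ≡⟨ ∑-distrib-+ V _ _ ⟨
      ∑[ v ∈ V ] (∑[ w ∈ V ] (c v w * χ (P v w)) + ∑[ w ∈ V ] (c v w * χ (not (P v w))))
                                                                           ≡⟨ ∑-cong V (λ v → ∑-distrib-+ V _ _) ⟨
      ∑[ v ∈ V ] ∑[ w ∈ V ] (c v w * χ (P v w) + c v w * χ (not (P v w)))  ≡⟨ ∑-cong V (λ v → ∑-cong V (λ w → split (c v w) (P v w))) ⟩
      ∑[ v ∈ V ] ∑[ w ∈ V ] c v w                                          ≡⟨ ∑-*-∑ V V _ _ ⟨
      size t * size t                                                      ∎
      where
      open ≡-Reasoning
      c : Fin N → Fin N → ℕ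
      c v w = χ (inU t v) * χ (inU t w)
      split : ∀ c b → c * χ b + c * χ (not b) ≡ c
      split c b = trans (sym (*-distribˡ-+ c (χ b) _)) (trans (cong (c *_) (χ+χ-not b)) (*-identityʳ c))

    U : Tuple m n⁺ → Subset N
    U t = tabulate (inU t)

    ∣U∣≡size : ∀ t → ∣ U t ∣ ≡ size t
    ∣U∣≡size t = ∣tabulate∣≡∑χ (inU t)

    countPairsIn-U≡pairsIn : ∀ t P → countPairsIn (U t) P ≡ pairsIn t P
    countPairsIn-U≡pairsIn t P =
      trans (countPairsIn-tabulate (inU t) P) (∑-cong V (λ v → ∑-cong V (λ w → χ-∧³ (inU t v) (inU t w) (P v w))))

    ∈U⇒highDegree : ∀ t u → u ∈ U t → q * Q ≤ 2 * p * degree H u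
    ∈U⇒highDegree t u u∈U = does∧≡true⇒ (q * Q ≤? 2 * p * degree H u) (∈-tabulate⁻ u∈U)

    module _ (a b : ℕ) {Good : Fin N → Fin N → Set} (good? : ∀ v w → Dec (Good v w)) where

      good : Fin N → Fin N → Bool
      good v w = does (good? v w)

      badPairs : Tuple m n⁺ → ℕ
      badPairs t = pairsIn t (λ v w → not (good v w))

      ∑badPairs≡∑legs : ∑ T badPairs ≡
        ∑[ v ∈ V ] ∑[ w ∈ V ] (χ (highDegree v) * χ (highDegree w) * χ (not (good v w)) * legs H v w)
      ∑badPairs≡∑legs = begin
        ∑[ t ∈ T ] ∑[ v ∈ V ] ∑[ w ∈ V ] (χ (inU t v) * χ (inU t w) * bad v w)
            ≡⟨ trans (∑-comm T V _) (∑-cong V (λ v → ∑-comm T V _)) ⟩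
        ∑[ v ∈ V ] ∑[ w ∈ V ] ∑[ t ∈ T ] (χ (inU t v) * χ (inU t w) * bad v w)
            ≡⟨ ∑-cong V (λ v → ∑-cong V (λ w → ∑-cong T (λ t → split v w t))) ⟩
        ∑[ v ∈ V ] ∑[ w ∈ V ] ∑[ t ∈ T ] (c v w * χ (H (cons v t) ∧ H (cons w t)))
            ≡⟨ ∑-cong V (λ v → ∑-cong V (λ w → sym (*-distribˡ-∑ (c v w) T _))) ⟩
        ∑[ v ∈ V ] ∑[ w ∈ V ] (c v w * ∑[ t ∈ T ] χ (H (cons v t) ∧ H (cons w t)))
            ≡⟨ ∑-cong V (λ v → ∑-cong V (λ w → cong (c v w *_) (sym (countB≡∑χ _ T)))) ⟩
        ∑[ v ∈ V ] ∑[ w ∈ V ] (c v w * legs H v w) ∎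
        where
        open ≡-Reasoning
        bad : Fin N → Fin N → ℕ
        bad v w = χ (not (good v w))
        c : Fin N → Fin N → ℕ
        c v w = χ (highDegree v) * χ (highDegree w) * bad v w
        regroup : ∀ hv ev hw ew c → hv * ev * (hw * ew) * c ≡ hv * hw * c * (ev * ew)
        regroup = solve-∀
        split : ∀ v w t → χ (inU t v) * χ (inU t w) * bad v w ≡ c v w * χ (H (cons v t) ∧ H (cons w t))
        split v w t = begin
          χ (inU t v) * χ (inU t w) * bad v w
            ≡⟨ cong₂ (λ x y → x * y * bad v w) (χ-∧ (highDegree v) _) (χ-∧ (highDegree w) _) ⟩
          χ (highDegree v) * χ (H (cons v t)) * (χ (highDegree w) * χ (H (cons w t))) * bad v w
            ≡⟨ regroup (χ (highDegree v)) (χ (H (cons v t))) (χ (highDegree w)) (χ (H (cons w t))) (bad v w) ⟩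
          c v w * (χ (H (cons v t)) * χ (H (cons w t)))
            ≡⟨ cong (c v w *_) (χ-∧ (H (cons v t)) _) ⟨
          c v w * χ (H (cons v t) ∧ H (cons w t)) ∎

      ∑badPairs-upper : (∀ v w → ¬ Good v w → 2 * p * p * b * legs H v w < a * q * q * Q) →
                        2 * p * p * (b * ∑ T badPairs) ≤ u₀ * u₀ * (a * q * q * Q)
      ∑badPairs-upper fewLegs = begin
        2 * p * p * (b * ∑ T badPairs)                              ≡⟨ *-assoc (2 * p * p) b _ ⟨
        c * ∑ T badPairs                                            ≡⟨ cong (c *_) ∑badPairs≡∑legs ⟩
        c * ∑[ v ∈ V ] ∑[ w ∈ V ] (h v * h w * bad v w * legs H v w)
            ≡⟨ trans (*-distribˡ-∑ c V _) (∑-cong V (λ v → *-distribˡ-∑ c V _)) ⟩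
        ∑[ v ∈ V ] ∑[ w ∈ V ] (c * (h v * h w * bad v w * legs H v w))
            ≤⟨ ∑-mono-≤ V (λ v → ∑-mono-≤ V (λ w → pointwise (h v) (h w) (good? v w) (fewLegs v w))) ⟩
        ∑[ v ∈ V ] ∑[ w ∈ V ] (h v * h w * K)                     ≡⟨ ∑-cong V (λ v → ∑-cong V (λ w → *-assoc (h v) (h w) K)) ⟩
        ∑[ v ∈ V ] ∑[ w ∈ V ] (h v * (h w * K))                   ≡⟨ ∑-*-∑ V V h _ ⟨
        u₀ * ∑[ w ∈ V ] (h w * K)                                   ≡⟨ cong (u₀ *_) (*-distribʳ-∑ K V h) ⟨
        u₀ * (u₀ * K)                                               ≡⟨ *-assoc u₀ u₀ K ⟨
        u₀ * u₀ * K                                                 ∎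
        where
        open ≤-Reasoning
        c = 2 * p * p * b
        K = a * q * q * Q
        h : Fin N → ℕ
        h u = χ (highDegree u)
        bad : Fin N → Fin N → ℕ
        bad v w = χ (not (good v w))
        pointwise : ∀ hv hw {G} (G? : Dec G) {L} → (¬ G → c * L < K) →
                    c * (hv * hw * χ (not (does G?)) * L) ≤ hv * hw * K
        pointwise hv hw (yes _) {L} _ =
          subst (_≤ hv * hw * K) (sym (trans (cong (λ x → c * (x * L)) (*-zeroʳ (hv * hw))) (*-zeroʳ c))) z≤n
        pointwise hv hw (no ¬g) {L} few = begin
          c * (hv * hw * 1 * L)   ≡⟨ regroup c hv hw L ⟩
          hv * hw * (c * L)       ≤⟨ *-monoʳ-≤ (hv * hw) (<⇒≤ (few ¬g)) ⟩
          hv * hw * K             ∎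
          where
          regroup : ∀ c hv hw L → c * (hv * hw * 1 * L) ≡ hv * hw * (c * L)
          regroup = solve-∀

      -- With ε = a/b, demand t ≤ supply t says (N/4K)² + badPairs t/ε ≤ (size t)².
      demand supply : Tuple m n⁺ → ℕ
      demand t = a * (N * q * (N * q)) + 16 * p * p * (b * badPairs t)
      supply t = 16 * p * p * (a * (size t * size t))

      ∃demand≤supply : .{{_ : NonZero Q}} → N * (q * Q) ≤ p * numEdges H →
                       (∀ v w → ¬ Good v w → 2 * p * p * b * legs H v w < a * q * q * Q) →
                       Σ (Tuple m n⁺) λ t → demand t ≤ supply t
      ∃demand≤supply edges fewLegs = ∑-≤⇒∃-≤ T 0<|T| (begin
        ∑ T demand                                                          ≡⟨ ∑demand ⟩
        Q * (a * (N * q * (N * q))) + 16 * p * p * (b * ∑ T badPairs)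
            ≤⟨ average-demand≤supply {p} {q} {a} {b} {N} {u₀} {Q} {highEdges}
                 u₀≤N (highEdges-lower edges) cauchy-schwarz-size (∑badPairs-upper fewLegs) ⟩
        16 * p * p * (a * ∑[ t ∈ T ] (size t * size t))                    ≡⟨ ∑supply ⟩
        ∑ T supply                                                          ∎)
        where
        open ≤-Reasoning
        0<|T| : 0 < length T
        0<|T| = subst (0 <_) (sym (length-allTuples m n⁺)) (>-nonZero⁻¹ Q)
        cauchy-schwarz-size : highEdges * highEdges ≤ Q * ∑[ t ∈ T ] (size t * size t)
        cauchy-schwarz-size = subst₂ (λ s l → s * s ≤ l * ∑[ t ∈ T ] (size t * size t))
                                    ∑size≡highEdges (length-allTuples m n⁺) (cauchy-schwarz T size)
        ∑demand : ∑ T demand ≡ Q * (a * (N * q * (N * q))) + 16 * p * p * (b * ∑ T badPairs)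
        ∑demand = trans (∑-distrib-+ T _ _) (cong₂ _+_
          (trans (∑-const T _) (cong (_* (a * (N * q * (N * q)))) (length-allTuples m n⁺)))
          (sym (trans (cong (16 * p * p *_) (*-distribˡ-∑ b T badPairs)) (*-distribˡ-∑ (16 * p * p) T _))))
        ∑supply : 16 * p * p * (a * ∑[ t ∈ T ] (size t * size t)) ≡ ∑ T supply
        ∑supply = trans (cong (16 * p * p *_) (*-distribˡ-∑ a T _)) (*-distribˡ-∑ (16 * p * p) T _)

      demand≤supply⇒U-dense : .{{_ : NonZero p}} .{{_ : NonZero a}} → ∀ t → demand t ≤ supply t →
          N * q ≤ 4 * p * ∣ U t ∣
        × b * (∣ U t ∣ * ∣ U t ∣) ≤ b * countPairsIn (U t) good + a * (∣ U t ∣ * ∣ U t ∣)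
      demand≤supply⇒U-dense t demand≤supply =
        subst (λ s → N * q ≤ 4 * p * s) (sym (∣U∣≡size t)) large ,
        subst₂ (λ s G → b * (s * s) ≤ b * G + a * (s * s))
               (sym (∣U∣≡size t)) (sym (countPairsIn-U≡pairsIn t good)) dense
        where
        open ≤-Reasoning
        success : b * badPairs t ≤ a * (size t * size t) × N * q ≤ 4 * p * size t
        success = demand≤supply⇒success {p} {q} {a} {b} {N} {size t} {badPairs t} demand≤supply
        large : N * q ≤ 4 * p * size t
        large = proj₂ success
        dense : b * (size t * size t) ≤ b * pairsIn t good + a * (size t * size t)
        dense = begin
          b * (size t * size t)                              ≡⟨ cong (b *_) (pairsIn+pairsIn-not≡size² t good) ⟨
          b * (pairsIn t good + badPairs t)                  ≡⟨ *-distribˡ-+ b (pairsIn t good) (badPairs t) ⟩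
          b * pairsIn t good + b * badPairs t                ≤⟨ +-monoʳ-≤ (b * pairsIn t good) (proj₁ success) ⟩
          b * pairsIn t good + a * (size t * size t)         ∎

      dependentRandomChoice : .{{_ : NonZero p}} .{{_ : NonZero a}} .{{_ : NonZero Q}} →
        N * (q * Q) ≤ p * numEdges H →
        (∀ v w → ¬ Good v w → 2 * p * p * b * legs H v w < a * q * q * Q) →
        Σ (Subset N) λ U →
            N * q ≤ 4 * p * ∣ U ∣
          × b * (∣ U ∣ * ∣ U ∣) ≤ b * countPairsIn U good + a * (∣ U ∣ * ∣ U ∣)
          × (∀ u → u ∈ U → q * Q ≤ 2 * p * degree H u)
      dependentRandomChoice edges fewLegs =
        let t , demand≤supply = ∃demand≤supply edges fewLegs
            large , dense = demand≤supply⇒U-dense t demand≤supply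
        in U t , large , dense , ∈U⇒highDegree t

module Rationals where

  open import Data.Integer as ℤ using (+_; +[1+_]; -[1+_])
  import Data.Integer.Properties as ℤ
  open import Data.Nat as ℕ using (ℕ; suc)
  import Data.Nat.Properties as ℕ
  open import Data.Nat.Coprimality using (Coprime; 1-coprimeTo)
  import Data.Nat.Coprimality as Coprime
  open import Data.Product using (∃₂; _,_)
  open import Data.Rational
  open import Data.Rational.Properties
  import Data.Rational.Unnormalised as ℚᵘ
  import Data.Rational.Unnormalised.Properties as ℚᵘ
  open import Data.Rational.Solver using (module +-*-Solver)
  open import Relation.Binary.PropositionalEquality
  open import Relation.Nullary using (¬_)
  open import Defs using (ℕ→ℚ; inv)

  private
    coprime-1 : ∀ k → Coprime k 1
    coprime-1 k = Coprime.sym (1-coprimeTo k)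

  ℕ→ℚ≡mkℚ : ∀ k → ℕ→ℚ k ≡ mkℚ (+ k) 0 (coprime-1 k)
  ℕ→ℚ≡mkℚ k = normalize-coprime (coprime-1 k)

  ℕ→ℚ-homo-* : ∀ x y → ℕ→ℚ (x ℕ.* y) ≡ ℕ→ℚ x * ℕ→ℚ y
  ℕ→ℚ-homo-* x y rewrite ℕ→ℚ≡mkℚ x | ℕ→ℚ≡mkℚ y = cong (_/ 1) (ℤ.pos-* x y)

  ℕ→ℚ-homo-+ : ∀ x y → ℕ→ℚ (x ℕ.+ y) ≡ ℕ→ℚ x + ℕ→ℚ y
  ℕ→ℚ-homo-+ x y rewrite ℕ→ℚ≡mkℚ x | ℕ→ℚ≡mkℚ y =
    cong (_/ 1) (trans (ℤ.pos-+ x y) (sym (cong₂ ℤ._+_ (ℤ.*-identityʳ (+ x)) (ℤ.*-identityʳ (+ y)))))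

  ℕ→ℚ-mono-≤ : ∀ {x y} → x ℕ.≤ y → ℕ→ℚ x ≤ ℕ→ℚ y
  ℕ→ℚ-mono-≤ {x} {y} x≤y rewrite ℕ→ℚ≡mkℚ x | ℕ→ℚ≡mkℚ y =
    *≤* (subst₂ ℤ._≤_ (sym (ℤ.*-identityʳ (+ x))) (sym (ℤ.*-identityʳ (+ y))) (ℤ.+≤+ x≤y))

  ℕ→ℚ-cancel-≤ : ∀ {x y} → ℕ→ℚ x ≤ ℕ→ℚ y → x ℕ.≤ y
  ℕ→ℚ-cancel-≤ {x} {y} x≤y rewrite ℕ→ℚ≡mkℚ x | ℕ→ℚ≡mkℚ y
    with ℤ.+≤+ x≤y ← subst₂ ℤ._≤_ (ℤ.*-identityʳ (+ x)) (ℤ.*-identityʳ (+ y)) (drop-*≤* x≤y) = x≤y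

  ℕ→ℚ-cancel-< : ∀ {x y} → ℕ→ℚ x < ℕ→ℚ y → x ℕ.< y
  ℕ→ℚ-cancel-< {x} {y} x<y rewrite ℕ→ℚ≡mkℚ x | ℕ→ℚ≡mkℚ y
    with ℤ.+<+ x<y ← subst₂ ℤ._<_ (ℤ.*-identityʳ (+ x)) (ℤ.*-identityʳ (+ y)) (drop-*<* x<y) = x<y

  ℕ→ℚ-pos : ∀ k .{{_ : ℕ.NonZero k}} → Positive (ℕ→ℚ k)
  ℕ→ℚ-pos (suc k) rewrite ℕ→ℚ≡mkℚ (suc k) = _

  positive-fraction : ∀ r → 0ℚ < r → ∃₂ λ a b → r * ℕ→ℚ (suc b) ≡ ℕ→ℚ (suc a)
  positive-fraction r@(mkℚ +[1+ a ] b _) _ = a , b , toℚᵘ-injective (begin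
      toℚᵘ (r * ℕ→ℚ (suc b))             ≈⟨ toℚᵘ-homo-* r (ℕ→ℚ (suc b)) ⟩
      toℚᵘ r ℚᵘ.* toℚᵘ (ℕ→ℚ (suc b))     ≡⟨ cong (λ s → toℚᵘ r ℚᵘ.* toℚᵘ s) (ℕ→ℚ≡mkℚ (suc b)) ⟩
      ℚᵘ.mkℚᵘ +[1+ a ] b ℚᵘ.* ℚᵘ.mkℚᵘ (+ suc b) 0  ≈⟨ ℚᵘ.*≡* (trans (ℤ.*-identityʳ _) (cong (+[1+ a ] ℤ.*_) (cong +_ (sym (ℕ.*-identityʳ (suc b)))))) ⟩
      ℚᵘ.mkℚᵘ (+ suc a) 0                ≡⟨ cong toℚᵘ (ℕ→ℚ≡mkℚ (suc a)) ⟨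
      toℚᵘ (ℕ→ℚ (suc a))                 ∎)
    where open ℚᵘ.≃-Reasoning
  positive-fraction (mkℚ (+ 0) _ _) (*<* (ℤ.+<+ ()))
  positive-fraction (mkℚ -[1+ _ ] _ _) (*<* ())

  module _ {x : ℚ} (c : ℕ) {i : ℕ} .{{_ : ℕ.NonZero c}} (x*c≡i : x * ℕ→ℚ c ≡ ℕ→ℚ i) where

    private
      instance
        c>0 : Positive (ℕ→ℚ c)
        c>0 = ℕ→ℚ-pos c

      ℕ→ℚ-c*j : ∀ j → ℕ→ℚ (c ℕ.* j) ≡ ℕ→ℚ j * ℕ→ℚ c
      ℕ→ℚ-c*j j = trans (ℕ→ℚ-homo-* c j) (*-comm (ℕ→ℚ c) (ℕ→ℚ j))

    i≤c*j⇒x≤j : ∀ {j} → i ℕ.≤ c ℕ.* j → x ≤ ℕ→ℚ j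
    i≤c*j⇒x≤j {j} i≤c*j = *-cancelʳ-≤-pos (ℕ→ℚ c) (begin
      x * ℕ→ℚ c       ≡⟨ x*c≡i ⟩
      ℕ→ℚ i           ≤⟨ ℕ→ℚ-mono-≤ i≤c*j ⟩
      ℕ→ℚ (c ℕ.* j)   ≡⟨ ℕ→ℚ-c*j j ⟩
      ℕ→ℚ j * ℕ→ℚ c   ∎)
      where open ≤-Reasoning

    x≤j⇒i≤c*j : ∀ {j} → x ≤ ℕ→ℚ j → i ℕ.≤ c ℕ.* j
    x≤j⇒i≤c*j {j} x≤j = ℕ→ℚ-cancel-≤ (begin
      ℕ→ℚ i           ≡⟨ x*c≡i ⟨
      x * ℕ→ℚ c       ≤⟨ *-monoʳ-≤-nonNeg (ℕ→ℚ c) {{pos⇒nonNeg (ℕ→ℚ c)}} x≤j ⟩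
      ℕ→ℚ j * ℕ→ℚ c   ≡⟨ ℕ→ℚ-c*j j ⟨
      ℕ→ℚ (c ℕ.* j)   ∎)
      where open ≤-Reasoning

    j<x⇒c*j<i : ∀ {j} → ℕ→ℚ j < x → c ℕ.* j ℕ.< i
    j<x⇒c*j<i {j} j<x = ℕ→ℚ-cancel-< (begin-strict
      ℕ→ℚ (c ℕ.* j)   ≡⟨ ℕ→ℚ-c*j j ⟩
      ℕ→ℚ j * ℕ→ℚ c   <⟨ *-monoˡ-<-pos (ℕ→ℚ c) j<x ⟩
      x * ℕ→ℚ c       ≡⟨ x*c≡i ⟩
      ℕ→ℚ i           ∎)
      where open ≤-Reasoning

  module Fractions (K ε : ℚ) .{{_ : Positive K}} (p q a b : ℕ) .{{_ : ℕ.NonZero p}} .{{_ : ℕ.NonZero b}}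
                   (K*q≡p : K * ℕ→ℚ q ≡ ℕ→ℚ p) (ε*b≡a : ε * ℕ→ℚ b ≡ ℕ→ℚ a) where

    private
      p′ = ℕ→ℚ p
      q′ = ℕ→ℚ q
      open +-*-Solver

    K⁻¹*p≡q : inv K * p′ ≡ q′
    K⁻¹*p≡q = begin
      inv K * p′          ≡⟨ cong (inv K *_) K*q≡p ⟨
      inv K * (K * q′)    ≡⟨ *-assoc (inv K) K q′ ⟨
      inv K * K * q′      ≡⟨ cong (_* q′) (*-inverseˡ K {{pos⇒nonZero K}}) ⟩
      1ℚ * q′             ≡⟨ *-identityˡ q′ ⟩
      q′                  ∎
      where open ≡-Reasoning

    edges-bound : ∀ N Q E → ℕ→ℚ (N ℕ.* Q) * inv K ≤ ℕ→ℚ E → N ℕ.* (q ℕ.* Q) ℕ.≤ p ℕ.* E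
    edges-bound N Q E = x≤j⇒i≤c*j p (begin
      ℕ→ℚ (N ℕ.* Q) * inv K * p′     ≡⟨ *-assoc (ℕ→ℚ (N ℕ.* Q)) (inv K) p′ ⟩
      ℕ→ℚ (N ℕ.* Q) * (inv K * p′)   ≡⟨ cong (ℕ→ℚ (N ℕ.* Q) *_) K⁻¹*p≡q ⟩
      ℕ→ℚ (N ℕ.* Q) * q′             ≡⟨ ℕ→ℚ-homo-* (N ℕ.* Q) q ⟨
      ℕ→ℚ (N ℕ.* Q ℕ.* q)            ≡⟨ cong ℕ→ℚ (ℕ.*-assoc N Q q) ⟩
      ℕ→ℚ (N ℕ.* (Q ℕ.* q))          ≡⟨ cong (λ y → ℕ→ℚ (N ℕ.* y)) (ℕ.*-comm Q q) ⟩
      ℕ→ℚ (N ℕ.* (q ℕ.* Q))          ∎)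
      where open ≡-Reasoning

    size-bound : ∀ N X → N ℕ.* q ℕ.≤ 4 ℕ.* p ℕ.* X → ℕ→ℚ N * ½ * ½ * inv K ≤ ℕ→ℚ X
    size-bound N X = i≤c*j⇒x≤j (4 ℕ.* p) {{ℕ.m*n≢0 4 p}} (begin
      ℕ→ℚ N * ½ * ½ * inv K * ℕ→ℚ (4 ℕ.* p)   ≡⟨ cong (ℕ→ℚ N * ½ * ½ * inv K *_) (ℕ→ℚ-homo-* 4 p) ⟩
      ℕ→ℚ N * ½ * ½ * inv K * (ℕ→ℚ 4 * p′)    ≡⟨ solve 5 (λ N h k f p → N :* h :* h :* k :* (f :* p) := N :* (k :* p) :* (h :* h :* f))
                                                     refl (ℕ→ℚ N) ½ (inv K) (ℕ→ℚ 4) p′ ⟩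
      ℕ→ℚ N * (inv K * p′) * (½ * ½ * ℕ→ℚ 4)  ≡⟨ cong (λ y → ℕ→ℚ N * y * 1ℚ) K⁻¹*p≡q ⟩
      ℕ→ℚ N * q′ * 1ℚ                         ≡⟨ *-identityʳ (ℕ→ℚ N * q′) ⟩
      ℕ→ℚ N * q′                              ≡⟨ ℕ→ℚ-homo-* N q ⟨
      ℕ→ℚ (N ℕ.* q)                           ∎)
      where open ≡-Reasoning

    degree-bound : ∀ Q d → q ℕ.* Q ℕ.≤ 2 ℕ.* p ℕ.* d → ½ * inv K * ℕ→ℚ Q ≤ ℕ→ℚ d
    degree-bound Q d = i≤c*j⇒x≤j (2 ℕ.* p) {{ℕ.m*n≢0 2 p}} (begin
      ½ * inv K * ℕ→ℚ Q * ℕ→ℚ (2 ℕ.* p)      ≡⟨ cong (½ * inv K * ℕ→ℚ Q *_) (ℕ→ℚ-homo-* 2 p) ⟩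
      ½ * inv K * ℕ→ℚ Q * (ℕ→ℚ 2 * p′)       ≡⟨ solve 5 (λ h k Q t p → h :* k :* Q :* (t :* p) := (k :* p) :* Q :* (h :* t))
                                                    refl ½ (inv K) (ℕ→ℚ Q) (ℕ→ℚ 2) p′ ⟩
      (inv K * p′) * ℕ→ℚ Q * (½ * ℕ→ℚ 2)     ≡⟨ cong (λ y → y * ℕ→ℚ Q * 1ℚ) K⁻¹*p≡q ⟩
      q′ * ℕ→ℚ Q * 1ℚ                        ≡⟨ *-identityʳ (q′ * ℕ→ℚ Q) ⟩
      q′ * ℕ→ℚ Q                             ≡⟨ ℕ→ℚ-homo-* q Q ⟨
      ℕ→ℚ (q ℕ.* Q)                          ∎)
      where open ≡-Reasoning

    legs-bound : ∀ Q L → ¬ (ε * ½ * inv K * inv K * ℕ→ℚ Q ≤ ℕ→ℚ L) →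
                 2 ℕ.* p ℕ.* p ℕ.* b ℕ.* L ℕ.< a ℕ.* q ℕ.* q ℕ.* Q
    legs-bound Q L few = j<x⇒c*j<i (2 ℕ.* p ℕ.* p ℕ.* b) {{2ppb≢0}} (begin
      ε * ½ * inv K * inv K * ℕ→ℚ Q * ℕ→ℚ (2 ℕ.* p ℕ.* p ℕ.* b)
        ≡⟨ cong (ε * ½ * inv K * inv K * ℕ→ℚ Q *_) ℕ→ℚ-2ppb ⟩
      ε * ½ * inv K * inv K * ℕ→ℚ Q * (ℕ→ℚ 2 * p′ * p′ * ℕ→ℚ b)
        ≡⟨ solve 7 (λ e h k Q t p b → e :* h :* k :* k :* Q :* (t :* p :* p :* b) := (e :* b) :* (k :* p) :* (k :* p) :* (h :* t) :* Q)
                 refl ε ½ (inv K) (ℕ→ℚ Q) (ℕ→ℚ 2) p′ (ℕ→ℚ b) ⟩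
      (ε * ℕ→ℚ b) * (inv K * p′) * (inv K * p′) * (½ * ℕ→ℚ 2) * ℕ→ℚ Q
        ≡⟨ cong₂ (λ x y → x * y * y * 1ℚ * ℕ→ℚ Q) ε*b≡a K⁻¹*p≡q ⟩
      ℕ→ℚ a * q′ * q′ * 1ℚ * ℕ→ℚ Q
        ≡⟨ cong (_* ℕ→ℚ Q) (*-identityʳ (ℕ→ℚ a * q′ * q′)) ⟩
      ℕ→ℚ a * q′ * q′ * ℕ→ℚ Q
        ≡⟨ ℕ→ℚ-aqqQ ⟨
      ℕ→ℚ (a ℕ.* q ℕ.* q ℕ.* Q) ∎) (≰⇒> few)
      where
      open ≡-Reasoning
      2ppb≢0 : ℕ.NonZero (2 ℕ.* p ℕ.* p ℕ.* b)
      2ppb≢0 = ℕ.m*n≢0 (2 ℕ.* p ℕ.* p) b {{ℕ.m*n≢0 (2 ℕ.* p) p {{ℕ.m*n≢0 2 p}}}}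
      ℕ→ℚ-2ppb : ℕ→ℚ (2 ℕ.* p ℕ.* p ℕ.* b) ≡ ℕ→ℚ 2 * p′ * p′ * ℕ→ℚ b
      ℕ→ℚ-2ppb = trans (ℕ→ℚ-homo-* (2 ℕ.* p ℕ.* p) b)
                  (cong (_* ℕ→ℚ b) (trans (ℕ→ℚ-homo-* (2 ℕ.* p) p) (cong (_* p′) (ℕ→ℚ-homo-* 2 p))))
      ℕ→ℚ-aqqQ : ℕ→ℚ (a ℕ.* q ℕ.* q ℕ.* Q) ≡ ℕ→ℚ a * q′ * q′ * ℕ→ℚ Q
      ℕ→ℚ-aqqQ = trans (ℕ→ℚ-homo-* (a ℕ.* q ℕ.* q) Q)
                  (cong (_* ℕ→ℚ Q) (trans (ℕ→ℚ-homo-* (a ℕ.* q) q) (cong (_* q′) (ℕ→ℚ-homo-* a q))))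

    pairs-bound : ∀ X G → b ℕ.* X ℕ.≤ b ℕ.* G ℕ.+ a ℕ.* X → (1ℚ - ε) * ℕ→ℚ X ≤ ℕ→ℚ G
    pairs-bound X G b*X≤b*G+a*X = *-cancelʳ-≤-pos b′ {{ℕ→ℚ-pos b}} (begin
      (1ℚ - ε) * X′ * b′           ≡⟨ solve 3 (λ ε b X → (con 1ℚ :- ε) :* X :* b := b :* X :- ε :* b :* X) refl ε b′ X′ ⟩
      b′ * X′ - ε * b′ * X′        ≡⟨ cong (λ y → b′ * X′ - y * X′) ε*b≡a ⟩
      b′ * X′ - a′ * X′            ≤⟨ +-monoˡ-≤ (- (a′ * X′)) (subst₂ _≤_ (ℕ→ℚ-homo-* b X) ℕ→ℚ-b*G+a*X (ℕ→ℚ-mono-≤ b*X≤b*G+a*X)) ⟩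
      b′ * G′ + a′ * X′ - a′ * X′  ≡⟨ solve 4 (λ a b X G → b :* G :+ a :* X :- a :* X := G :* b) refl a′ b′ X′ G′ ⟩
      G′ * b′                      ∎)
      where
      open ≤-Reasoning
      a′ = ℕ→ℚ a
      b′ = ℕ→ℚ b
      X′ = ℕ→ℚ X
      G′ = ℕ→ℚ G
      ℕ→ℚ-b*G+a*X : ℕ→ℚ (b ℕ.* G ℕ.+ a ℕ.* X) ≡ b′ * G′ + a′ * X′
      ℕ→ℚ-b*G+a*X = trans (ℕ→ℚ-homo-+ (b ℕ.* G) (a ℕ.* X)) (cong₂ _+_ (ℕ→ℚ-homo-* b G) (ℕ→ℚ-homo-* a X))

open import Defs
open import Data.Nat using (ℕ; suc; _≤_) renaming (_*_ to _*ℕ_)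
open import Data.Fin using (Fin; zero; suc)
open import Data.Fin.Subset using (Subset; _∈_; ∣_∣)
open import Data.Product using (Σ; _×_)
open import Data.Rational using (ℚ; 0ℚ; 1ℚ; ½; _<_; _*_; _-_; Positive)
open import Data.Rational using () renaming (_≤_ to _≤ℚ_)
open import Relation.Nullary.Decidable using (does)
open import Data.Rational.Properties using (_≤?_)

open import Data.Nat using (NonZero)
open import Relation.Nullary using (Dec)
open import Data.Product using (_,_)
open import Data.Rational.Properties using (positive⁻¹)
open HypergraphCounting using (prodSizes-nonZero)
open DependentRandomChoice using (dependentRandomChoice)
open Rationals

lemma2p5 : (m : ℕ) → 1 ≤ m →
    (K : ℚ) → .{{_ : Positive K}} →
    (ε : ℚ) → 0ℚ < ε → ε < 1ℚ →
    (n : Fin (suc m) → ℕ) → (∀ i → 1 ≤ n i) →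
    (H : Hypergraph (suc m) n) →
    ℕ→ℚ (prodSizes (suc m) n) * inv K ≤ℚ ℕ→ℚ (numEdges H) →
    Σ (Subset (n zero)) λ U →
      (ℕ→ℚ (n zero) * ½ * ½ * inv K ≤ℚ ℕ→ℚ ∣ U ∣)
      × ((1ℚ - ε) * ℕ→ℚ (∣ U ∣ *ℕ ∣ U ∣)
          ≤ℚ ℕ→ℚ (countPairsIn U (λ v w →
              does (ε * ½ * inv K * inv K * ℕ→ℚ (prodSizes m (λ i → n (suc i)))
                      ≤? ℕ→ℚ (legs H v w)))))
      × (∀ u → u ∈ U →
          ½ * inv K * ℕ→ℚ (prodSizes m (λ i → n (suc i))) ≤ℚ ℕ→ℚ (degree H u))
lemma2p5 m _ K ε ε>0 _ n n≥1 H manyEdges =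
  let p , q , K*q≡p = positive-fraction K (positive⁻¹ K)
      a , b , ε*b≡a = positive-fraction ε ε>0
      open Fractions K ε (suc p) (suc q) (suc a) (suc b) K*q≡p ε*b≡a
      U , large , dense , highDegree =
        dependentRandomChoice H (suc p) (suc q) (suc a) (suc b) manyLegs?
          (edges-bound (n zero) Q (numEdges H) manyEdges)
          (λ v w → legs-bound Q (legs H v w))
  in U
   , size-bound (n zero) ∣ U ∣ large
   , pairs-bound (∣ U ∣ *ℕ ∣ U ∣) (countPairsIn U (λ v w → does (manyLegs? v w))) dense
   , λ u u∈U → degree-bound Q (degree H u) (highDegree u u∈U)
  where
  Q : ℕ
  Q = prodSizes m (λ i → n (suc i))
  instance
    Q≢0 : NonZero Q
    Q≢0 = prodSizes-nonZero m (λ i → n (suc i)) (λ i → n≥1 (suc i))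
  manyLegs? : ∀ v w → Dec (ε * ½ * inv K * inv K * ℕ→ℚ Q ≤ℚ ℕ→ℚ (legs H v w))
  manyLegs? v w = ε * ½ * inv K * inv K * ℕ→ℚ Q ≤? ℕ→ℚ (legs H v w)
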